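{- There are constants $c,d>0$ such that for every sufficiently large natural number $n$ there are at least $\lfloor 2^n/d\rfloor$ binary strings $x$ with $n-c \leq l(x) \leq n$ and $C(x\mid n) > n$; likewise, there are constants $c,d>0$ such that for every sufficiently large $n$ there are at least $\lfloor 2^n/d\rfloor$ binary strings $x$ with $n-c\le l(x)\le n$ and $C(x) > n$.
   Context: Fix a standard enumeration $T_0,T_1,\ldots$ of Turing machines and a universal Turing machine $U$ with $U(\langle\langle i,p\rangle,y\rangle)=T_i(\langle p,y\rangle)$, where $\langle\cdot,\cdot\rangle$ is a standard one-to-one pairing of strings. The conditional Kolmogorov complexity is $C(x\mid y)=\min\{l(p): U(\langle p,y\rangle)=x\}$, where $l(p)$ is the length of the binary string $p$, and $C(x)=C(x\mid\epsilon)$ with $\epsilon$ the empty string. Natural numbers are identified with binary strings via the length-increasing lexicographic order ($\epsilon\mapsto 0$, $0\mapsto 1$, $1\mapsto 2$, $00\mapsto 3,\ldots$), so $C(x\mid n)$ makes sense. -}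

module Defs where

open import Data.Bool using (Bool; true; false)
open import Data.Nat using (ℕ; zero; suc; _≤_; _<_; _/_; _^_; >-nonZero)
open import Data.Fin using (Fin; zero; suc)
open import Data.Vec using (Vec; lookup)
open import Data.List using (List; []; _∷_; _++_; length; reverse; replicate)
open import Data.List.Relation.Unary.All using (All)
open import Data.List.Relation.Unary.Unique.Propositional using (Unique)
open import Data.Maybe using (Maybe; just; nothing)
open import Data.Product using (Σ; ∃; _×_; _,_)
open import Function using (_∘_)
open import Function.Bundles using (_⇔_)
open import Relation.Binary.PropositionalEquality using (_≡_)
open import Relation.Nullary using (¬_)

Str : Set
Str = List Bool

len : Str → ℕ
len = length

-- successor in the length-increasing lexicographic order,
-- acting on the REVERSED string (least significant bit first)
incRev : Str → Str
incRev []           = false ∷ []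
incRev (false ∷ xs) = true ∷ xs
incRev (true ∷ xs)  = false ∷ incRev xs

iterRev : ℕ → Str
iterRev zero    = []
iterRev (suc n) = incRev (iterRev n)

-- 0 ↦ ε, 1 ↦ 0, 2 ↦ 1, 3 ↦ 00, ...
natStr : ℕ → Str
natStr n = reverse (iterRev n)

-- Standard one-to-one pairing of strings (Li–Vitányi):
--   x̄ = 1^{l(x)} 0 x ,   ⟨x , y⟩ = \overline{l(x)} x y

bar : Str → Str
bar x = replicate (length x) true ++ (false ∷ x)

pair : Str → Str → Str
pair x y = bar (natStr (length x)) ++ x ++ y

-- Turing machines: one two-way infinite tape, alphabet {blank, 0, 1},
-- finite transition table, start state zero, halting when the table
-- entry is 'nothing'.

-- symbol 0 = blank, 1 = bit 0, 2 = bit 1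
Sym : Set
Sym = Fin 3

data Move : Set where
  L R : Move

record TM : Set where
  field
    nstates : ℕ      -- the machine has (suc nstates) states
    δ       : Vec (Vec (Maybe (Fin (suc nstates) × Sym × Move)) 3) (suc nstates)

-- tape: cells left of the head (nearest first), scanned cell, cells right
record Tape : Set where
  constructor tape
  field
    left  : List Sym
    here  : Sym
    right : List Sym

bitSym : Bool → Sym
bitSym false = suc zero
bitSym true  = suc (suc zero)

initTape : Str → Tape
initTape []       = tape [] zero []
initTape (b ∷ bs) = tape [] (bitSym b) (Data.List.map bitSym bs)

moveTape : Move → Tape → Tape
moveTape L (tape []      h r) = tape [] zero (h ∷ r)
moveTape L (tape (a ∷ l) h r) = tape l a (h ∷ r)
moveTape R (tape l h [])      = tape (h ∷ l) zero []
moveTape R (tape l h (a ∷ r)) = tape (h ∷ l) a r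

readWord : List Sym → Str
readWord []                      = []
readWord (zero ∷ _)              = []
readWord (suc zero ∷ s)          = false ∷ readWord s
readWord (suc (suc zero) ∷ s)    = true ∷ readWord s

output : Tape → Str
output (tape _ h r) = readWord (h ∷ r)

-- run with at most k steps; 'just out' iff the machine has halted
runFrom : (M : TM) → ℕ → Fin (suc (TM.nstates M)) → Tape → Maybe Str
runFrom M k q t with lookup (lookup (TM.δ M) q) (Tape.here t)
... | nothing = just (output t)
runFrom M zero    q t | just _ = nothing
runFrom M (suc k) q (tape l h r) | just (q' , w , m) =
  runFrom M k q' (moveTape m (tape l w r))

HaltsWith : TM → Str → Str → Set
HaltsWith M input out = ∃ λ k → runFrom M k zero (initTape input) ≡ just out

Enumerates : (ℕ → TM) → Set
Enumerates T = ∀ (M : TM) → ∃ λ i → T i ≡ M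

UniversalFor : (ℕ → TM) → TM → Set
UniversalFor T U = ∀ (i : ℕ) (p y out : Str) →
  HaltsWith U (pair (pair (natStr i) p) y) out ⇔ HaltsWith (T i) (pair p y) out

-- Kolmogorov complexity comparisons.
-- C(x ∣ y) = min { l(p) : U(⟨p,y⟩) = x }  (= ∞ if no such p), hence
-- C(x ∣ y) > n  iff  no p with l(p) ≤ n has U(⟨p,y⟩) = x.

CondCExceeds : TM → Str → Str → ℕ → Set
CondCExceeds U x y n = ∀ (p : Str) → len p ≤ n → ¬ HaltsWith U (pair p y) x

CExceeds : TM → Str → ℕ → Set
CExceeds U x n = CondCExceeds U x [] n

-- "there are at least ⌊2^n/d⌋ binary strings x with n-c ≤ l(x) ≤ n and P x"
-- (stated classically, i.e. double-negated)

AtLeastStrings : (d : ℕ) → 0 < d → (c n : ℕ) → (Str → Set) → Set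
AtLeastStrings d d>0 c n P =
  ¬ ¬ (Σ (List Str) λ xs →
         Unique xs
       × All (λ x → (n Data.Nat.∸ c ≤ len x) × (len x ≤ n) × P x) xs
       × (_/_ (2 ^ n) d {{>-nonZero d>0}}) ≤ length xs)

{-# OPTIONS --safe #-}
-- There are 2^(n+1) − 1 programs of length ≤ n, and U(⟨p, y⟩) has at most one
-- output, so at most that many strings x have C(x ∣ y) ≤ n.  Some program prefix w (the
-- index of a machine that never halts) wastes slots: with k = l(⟨w, ε⟩) and n = k + 1 + m,
-- the 2^(m+1) − 1 programs ⟨w, q⟩ with l(q) ≤ m have length ≤ n but describe nothing.
-- Hence among the 2^(n+1) − 2^m strings x with m ≤ l(x) ≤ n, at least 2^m = 2^n / 2^(k+1)
-- have C(x ∣ y) > n, for every y.  As the count is only claimed under double negation,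
-- each string can be classified as incompressible or described without deciding which.
module Submission where

open import Data.Bool using (true; false)
open import Data.Empty using (⊥-elim)
open import Data.Fin using (zero; suc)
open import Data.List using (List; []; _∷_; _++_; length; map)
open import Data.List.Properties
  using ( length-++; length-map; length-removeAt′; length-++-≤ˡ
        ; ++-assoc; ++-identityʳ; ++-cancelˡ; ∷-injectiveʳ)
open import Data.List.Membership.Propositional using (_∈_)
open import Data.List.Membership.Propositional.Properties
  using (∈-++⁺ˡ; ∈-++⁺ʳ; ∈-++⁻; ∈-map⁺; ∈-map⁻)
open import Data.List.Relation.Binary.Disjoint.Propositional using (Disjoint)
open import Data.List.Relation.Binary.Subset.Propositional using (_⊆_)
open import Data.List.Relation.Binary.Subset.Propositional.Properties using (∷⁺ʳ; All-resp-⊇)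
open import Data.List.Relation.Unary.All as All using (All; []; _∷_)
open import Data.List.Relation.Unary.All.Properties using (All¬⇒¬Any)
open import Data.List.Relation.Unary.AllPairs using ([]; _∷_)
open import Data.List.Relation.Unary.Any as Any using (Any; here; there; index; _─_)
open import Data.List.Relation.Unary.Unique.Propositional using (Unique)
import Data.List.Relation.Unary.Unique.Propositional.Properties as Unique
open import Data.Maybe using (just; nothing)
open import Data.Maybe.Properties using (just-injective)
open import Data.Nat
  using (ℕ; zero; suc; _+_; _*_; _∸_; _^_; _/_; _≤_; _<_; z≤n; s≤s; z<s; NonZero; >-nonZero)
open import Data.Nat.DivMod using (m*n/n≡m)
open import Data.Nat.Properties
  using ( +-suc; +-comm; *-comm; +-identityʳ; +-cancelˡ-≤; +-monoʳ-≤; ^-distribˡ-+-*; m^n>0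
        ; ≤-refl; ≤-pred; <⇒≤; ≤⇒≯; <-irrefl; n≤1+n; m<m+n; m≤n⇒m<n∨m≡n; m+n∸m≡n
        ; m≤n⇒∃[o]m+o≡n
        ; module ≤-Reasoning)
open import Data.Nat.Tactic.RingSolver using (solve-∀)
open import Data.Product using (Σ; ∃; _×_; _,_; proj₁; proj₂)
open import Data.Sum using (_⊎_; inj₁; inj₂; [_,_]′)
open import Data.Vec using (lookup; []; _∷_)
open import Function using (_∘_)
open import Function.Bundles using (Equivalence)
open import Level using (0ℓ)
open import Relation.Binary.PropositionalEquality
open import Relation.Nullary using (¬_)
open import Relation.Nullary.Negation using (¬¬-Monad; ¬¬-map)

open import Defs

module _ {A : Set} where

  ∈-─⁺ : ∀ {x y : A} {ys} (x∈ys : x ∈ ys) → y ∈ ys → x ≢ y → y ∈ (ys ─ x∈ys)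
  ∈-─⁺ (here refl)  (here refl)  x≢y = ⊥-elim (x≢y refl)
  ∈-─⁺ (here _)     (there y∈ys) _   = y∈ys
  ∈-─⁺ (there _)    (here y≡z)   _   = here y≡z
  ∈-─⁺ (there x∈ys) (there y∈ys) x≢y = there (∈-─⁺ x∈ys y∈ys x≢y)

  Unique-⊆⇒length≤ : ∀ {xs ys : List A} → Unique xs → xs ⊆ ys → length xs ≤ length ys
  Unique-⊆⇒length≤ {[]} _ _ = z≤n
  Unique-⊆⇒length≤ {x ∷ xs} {ys} (x≢xs ∷ xs!) xs⊆ys
    rewrite length-removeAt′ ys (index (xs⊆ys (here refl))) =
    s≤s (Unique-⊆⇒length≤ xs! λ y∈xs →
      ∈-─⁺ (xs⊆ys (here refl)) (xs⊆ys (there y∈xs)) (All.lookup x≢xs y∈xs))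

module _ {X P : Set} (Good : X → Set) (Describes : P → X → Set) where

  record Partition (xs : List X) : Set where
    field
      good                  : List X
      descriptions          : List P
      good⊆                 : good ⊆ xs
      good-unique           : Unique good
      all-good              : All Good good
      descriptions-unique   : Unique descriptions
      all-describe          : All (λ p → Any (Describes p) xs) descriptions
      length-partition      : length xs ≡ length good + length descriptions

  partition : (∀ p {x x′} → Describes p x → Describes p x′ → x ≡ x′) →
              ∀ {xs} → Unique xs → All (λ x → Good x ⊎ ∃ λ p → Describes p x) xs →
              Partition xs
  partition functional [] [] = record
    { good = [] ; descriptions = [] ; good⊆ = λ () ; good-unique = [] ; all-good = []
    ; descriptions-unique = [] ; all-describe = [] ; length-partition = refl }
  partition functional {x ∷ xs} (x≢xs ∷ xs!) (inj₁ gx ∷ rest) = record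
    { good                  = x ∷ good
    ; descriptions          = descriptions
    ; good⊆                 = ∷⁺ʳ x good⊆
    ; good-unique           = All-resp-⊇ good⊆ x≢xs ∷ good-unique
    ; all-good              = gx ∷ all-good
    ; descriptions-unique   = descriptions-unique
    ; all-describe          = All.map there all-describe
    ; length-partition      = cong suc length-partition
    }
    where open Partition (partition functional xs! rest)
  partition functional {x ∷ xs} (x≢xs ∷ xs!) (inj₂ (p , p↦x) ∷ rest) = record
    { good                  = good
    ; descriptions          = p ∷ descriptions
    ; good⊆                 = there ∘ good⊆
    ; good-unique           = good-unique
    ; all-good              = all-good
    ; descriptions-unique   = All.map (λ { p′↦xs refl → x∉xs (Any.map (functional p p↦x) p′↦xs) })
                                      all-describe ∷ descriptions-unique
    ; all-describe          = here p↦x ∷ All.map there all-describe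
    ; length-partition      = trans (cong suc length-partition) (sym (+-suc _ _))
    }
    where
    open Partition (partition functional xs! rest)
    x∉xs = All¬⇒¬Any x≢xs

runFrom-+ : ∀ M k j q t {out} → runFrom M k q t ≡ just out → runFrom M (k + j) q t ≡ just out
runFrom-+ M k j q t halted with lookup (lookup (TM.δ M) q) (Tape.here t)
... | nothing = halted
runFrom-+ M (suc k) j q (tape l h r) halted | just (q′ , s , m) = runFrom-+ M k j q′ _ halted

HaltsWith-functional : ∀ {M x out out′} → HaltsWith M x out → HaltsWith M x out′ → out ≡ out′
HaltsWith-functional {M} {x} (k , halted) (k′ , halted′) = just-injective (begin
  just _                      ≡⟨ runFrom-+ M k k′ zero t₀ halted ⟨
  runFrom M (k + k′) zero t₀  ≡⟨ cong (λ s → runFrom M s zero t₀) (+-comm k k′) ⟩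
  runFrom M (k′ + k) zero t₀  ≡⟨ runFrom-+ M k′ k zero t₀ halted′ ⟩
  just _                      ∎)
  where
  open ≡-Reasoning
  t₀ = initTape x

module _ (M : TM) (never-halts : ∀ q s → lookup (lookup (TM.δ M) q) s ≢ nothing) where

  runFrom-nothing : ∀ k q t → runFrom M k q t ≡ nothing
  runFrom-nothing k q t with lookup (lookup (TM.δ M) q) (Tape.here t) in entry
  ... | nothing = ⊥-elim (never-halts q (Tape.here t) entry)
  runFrom-nothing zero    q t            | just _            = refl
  runFrom-nothing (suc k) q (tape l h r) | just (q′ , s , m) = runFrom-nothing k q′ _

  ¬HaltsWith : ∀ x out → ¬ HaltsWith M x out
  ¬HaltsWith x out (k , halted) with () ← trans (sym (runFrom-nothing k zero (initTape x))) halted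

rightForever : TM
rightForever = record { nstates = 0 ; δ = (right ∷ right ∷ right ∷ []) ∷ [] }
  where right = just (zero , zero , R)

rightForever-never-halts : ∀ q s → lookup (lookup (TM.δ rightForever) q) s ≢ nothing
rightForever-never-halts zero zero ()
rightForever-never-halts zero (suc zero) ()
rightForever-never-halts zero (suc (suc zero)) ()

diverging-prefix : ∀ {T U} → Enumerates T → UniversalFor T U →
                   ∃ λ w → ∀ q y out → ¬ HaltsWith U (pair (pair w q) y) out
diverging-prefix {T} enum univ with i , Ti≡rightForever ← enum rightForever =
  natStr i , λ q y out halts →
    ¬HaltsWith rightForever rightForever-never-halts (pair q y) out
      (subst (λ M → HaltsWith M (pair q y) out) Ti≡rightForever
             (Equivalence.to (univ i q y out) halts))

stringsOfLength : ℕ → List Str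
stringsOfLength zero    = [] ∷ []
stringsOfLength (suc m) = map (true ∷_) (stringsOfLength m) ++ map (false ∷_) (stringsOfLength m)

length-stringsOfLength : ∀ m → length (stringsOfLength m) ≡ 2 ^ m
length-stringsOfLength zero    = refl
length-stringsOfLength (suc m) = begin
  length (map (true ∷_) S ++ map (false ∷_) S)
    ≡⟨ length-++ (map (true ∷_) S) ⟩
  length (map (true ∷_) S) + length (map (false ∷_) S)
    ≡⟨ cong₂ _+_ (length-map (true ∷_) S) (length-map (false ∷_) S) ⟩
  length S + length S
    ≡⟨ cong (λ l → l + l) (length-stringsOfLength m) ⟩
  2 ^ m + 2 ^ m
    ≡⟨ cong (2 ^ m +_) (+-identityʳ (2 ^ m)) ⟨
  2 ^ suc m
    ∎
  where
  open ≡-Reasoning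
  S = stringsOfLength m

∈-stringsOfLength⁺ : ∀ x → x ∈ stringsOfLength (len x)
∈-stringsOfLength⁺ []          = here refl
∈-stringsOfLength⁺ (true ∷ x)  = ∈-++⁺ˡ (∈-map⁺ (true ∷_) (∈-stringsOfLength⁺ x))
∈-stringsOfLength⁺ (false ∷ x) =
  ∈-++⁺ʳ (map (true ∷_) (stringsOfLength (len x))) (∈-map⁺ (false ∷_) (∈-stringsOfLength⁺ x))

∈-stringsOfLength⁻ : ∀ {m x} → x ∈ stringsOfLength m → len x ≡ m
∈-stringsOfLength⁻ {zero}  (here refl) = refl
∈-stringsOfLength⁻ {suc m} x∈ with ∈-++⁻ (map (true ∷_) (stringsOfLength m)) x∈
... | inj₁ x∈t with _ , x′∈ , refl ← ∈-map⁻ (true ∷_) x∈t  =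
  cong suc (∈-stringsOfLength⁻ x′∈)
... | inj₂ x∈f with _ , x′∈ , refl ← ∈-map⁻ (false ∷_) x∈f =
  cong suc (∈-stringsOfLength⁻ x′∈)

stringsOfLength-unique : ∀ m → Unique (stringsOfLength m)
stringsOfLength-unique zero    = [] ∷ []
stringsOfLength-unique (suc m) =
  Unique.++⁺ (Unique.map⁺ ∷-injectiveʳ S!) (Unique.map⁺ ∷-injectiveʳ S!) true≢false
  where
  S! = stringsOfLength-unique m
  true≢false : Disjoint (map (true ∷_) (stringsOfLength m)) (map (false ∷_) (stringsOfLength m))
  true≢false (v∈t , v∈f) with ∈-map⁻ (true ∷_) v∈t | ∈-map⁻ (false ∷_) v∈f
  ... | _ , _ , refl | _ , _ , ()

stringsOfLengths : ℕ → ℕ → List Str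
stringsOfLengths a zero    = []
stringsOfLengths a (suc b) = stringsOfLength a ++ stringsOfLengths (suc a) b

∈-stringsOfLengths⁺ : ∀ {a b x} → a ≤ len x → len x < a + b → x ∈ stringsOfLengths a b
∈-stringsOfLengths⁺ {a} {zero} {x} a≤x x<a+0 =
  ⊥-elim (≤⇒≯ a≤x (subst (len x <_) (+-identityʳ a) x<a+0))
∈-stringsOfLengths⁺ {a} {suc b} {x} a≤x x<a+b with m≤n⇒m<n∨m≡n a≤x
... | inj₂ refl = ∈-++⁺ˡ (∈-stringsOfLength⁺ x)
... | inj₁ a<x  =
  ∈-++⁺ʳ (stringsOfLength a) (∈-stringsOfLengths⁺ a<x (subst (len x <_) (+-suc a b) x<a+b))

∈-stringsOfLengths⁻ : ∀ {a b x} → x ∈ stringsOfLengths a b → a ≤ len x × len x < a + b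
∈-stringsOfLengths⁻ {a} {suc b} {x} x∈ with ∈-++⁻ (stringsOfLength a) x∈
... | inj₁ x∈a rewrite ∈-stringsOfLength⁻ x∈a = ≤-refl , m<m+n a z<s
... | inj₂ x∈rest with a<x , x<sa+b ← ∈-stringsOfLengths⁻ {suc a} {b} x∈rest =
  <⇒≤ a<x , subst (len x <_) (sym (+-suc a b)) x<sa+b

stringsOfLengths-unique : ∀ a b → Unique (stringsOfLengths a b)
stringsOfLengths-unique a zero    = []
stringsOfLengths-unique a (suc b) =
  Unique.++⁺ (stringsOfLength-unique a) (stringsOfLengths-unique (suc a) b) lengths-differ
  where
  lengths-differ : Disjoint (stringsOfLength a) (stringsOfLengths (suc a) b)
  lengths-differ (v∈a , v∈rest) =
    <-irrefl (sym (∈-stringsOfLength⁻ v∈a)) (proj₁ (∈-stringsOfLengths⁻ {suc a} {b} v∈rest))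

stringsOfLengths-+ : ∀ a b c →
  stringsOfLengths a (b + c) ≡ stringsOfLengths a b ++ stringsOfLengths (a + b) c
stringsOfLengths-+ a zero    c = cong (λ a′ → stringsOfLengths a′ c) (sym (+-identityʳ a))
stringsOfLengths-+ a (suc b) c = begin
  stringsOfLength a ++ stringsOfLengths (suc a) (b + c)
    ≡⟨ cong (stringsOfLength a ++_) (stringsOfLengths-+ (suc a) b c) ⟩
  stringsOfLength a ++ stringsOfLengths (suc a) b ++ stringsOfLengths (suc a + b) c
    ≡⟨ sym (++-assoc (stringsOfLength a) _ _) ⟩
  stringsOfLengths a (suc b) ++ stringsOfLengths (suc a + b) c
    ≡⟨ cong (λ a′ → stringsOfLengths a (suc b) ++ stringsOfLengths a′ c) (sym (+-suc a b)) ⟩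
  stringsOfLengths a (suc b) ++ stringsOfLengths (a + suc b) c
    ∎
  where open ≡-Reasoning

pair≡pair[]++ : ∀ x y → pair x y ≡ pair x [] ++ y
pair≡pair[]++ x y = begin
  bar b ++ x ++ y          ≡⟨ cong (λ x′ → bar b ++ x′ ++ y) (sym (++-identityʳ x)) ⟩
  bar b ++ (x ++ []) ++ y  ≡⟨ sym (++-assoc (bar b) (x ++ []) y) ⟩
  pair x [] ++ y           ∎
  where
  open ≡-Reasoning
  b = natStr (len x)

length-pair : ∀ x y → len (pair x y) ≡ len (pair x []) + len y
length-pair x y = trans (cong length (pair≡pair[]++ x y)) (length-++ (pair x []))

pair-injectiveʳ : ∀ {x y y′} → pair x y ≡ pair x y′ → y ≡ y′
pair-injectiveʳ {x} {y} {y′} eq =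
  ++-cancelˡ (pair x []) y y′ (trans (sym (pair≡pair[]++ x y)) (trans eq (pair≡pair[]++ x y′)))

m^[n+o]/m^n≡m^o : ∀ m n o .{{_ : NonZero (m ^ n)}} → m ^ (n + o) / m ^ n ≡ m ^ o
m^[n+o]/m^n≡m^o m n o = begin
  m ^ (n + o) / m ^ n    ≡⟨ cong (_/ m ^ n) (^-distribˡ-+-* m n o) ⟩
  m ^ n * m ^ o / m ^ n  ≡⟨ cong (_/ m ^ n) (*-comm (m ^ n) (m ^ o)) ⟩
  m ^ o * m ^ n / m ^ n  ≡⟨ m*n/n≡m (m ^ o) (m ^ n) ⟩
  m ^ o                  ∎
  where open ≡-Reasoning

d+[a+e]≤a+[g+d]⇒e≤g : ∀ a d e g → d + (a + e) ≤ a + (g + d) → e ≤ g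
d+[a+e]≤a+[g+d]⇒e≤g a d e g = +-cancelˡ-≤ (a + d) e g ∘ subst₂ _≤_ (lhs a d e) (rhs a d g)
  where
  lhs : ∀ a d e → d + (a + e) ≡ a + d + e
  lhs = solve-∀
  rhs : ∀ a d g → a + (g + d) ≡ a + d + g
  rhs = solve-∀

¬¬-exceeds-or-described : ∀ {U x y n} →
  ¬ ¬ (CondCExceeds U x y n ⊎ ∃ λ p → len p ≤ n × HaltsWith U (pair p y) x)
¬¬-exceeds-or-described ¬either =
  ¬either (inj₁ λ p p≤n halts → ¬either (inj₂ (p , p≤n , halts)))

module DivergingPrefix (U : TM) (w : Str)
                       (w-diverges : ∀ q y out → ¬ HaltsWith U (pair (pair w q) y) out) where

  k : ℕ
  k = len (pair w [])

  2^[1+k]>0 : 0 < 2 ^ suc k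
  2^[1+k]>0 = m^n>0 2 (suc k)

  -- AtLeastStrings divides using exactly this NonZero proof, so it must be the instance in scope.
  instance
    2^[1+k]≢0 : NonZero (2 ^ suc k)
    2^[1+k]≢0 = >-nonZero 2^[1+k]>0

  module Counting (y : Str) (m : ℕ) where

    n : ℕ
    n = suc k + m

    Incompressible : Str → Set
    Incompressible x = CondCExceeds U x y n

    Describes : Str → Str → Set
    Describes p x = len p ≤ n × HaltsWith U (pair p y) x

    describes-functional : ∀ p {x x′} → Describes p x → Describes p x′ → x ≡ x′
    describes-functional _ (_ , halts) (_ , halts′) = HaltsWith-functional {U} halts halts′

    shorter candidates programs diverging : List Str
    shorter    = stringsOfLengths 0 m
    candidates = stringsOfLengths m (suc (suc k))
    programs   = stringsOfLengths 0 (suc n)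
    diverging  = map (pair w) (stringsOfLengths 0 (suc m))

    candidates-unique : Unique candidates
    candidates-unique = stringsOfLengths-unique m (suc (suc k))

    diverging-unique : Unique diverging
    diverging-unique = Unique.map⁺ (pair-injectiveʳ {w}) (stringsOfLengths-unique 0 (suc m))

    length-programs : length programs ≡ length shorter + length candidates
    length-programs = begin
      length (stringsOfLengths 0 (suc (suc k) + m))
        ≡⟨ cong (length ∘ stringsOfLengths 0) (+-comm (suc (suc k)) m) ⟩
      length (stringsOfLengths 0 (m + suc (suc k)))
        ≡⟨ cong length (stringsOfLengths-+ 0 m (suc (suc k))) ⟩
      length (shorter ++ candidates)
        ≡⟨ length-++ shorter ⟩
      length shorter + length candidates
        ∎
      where open ≡-Reasoning

    length-diverging : length diverging ≡ length shorter + length (stringsOfLengths m 1)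
    length-diverging = begin
      length diverging
        ≡⟨ length-map (pair w) (stringsOfLengths 0 (suc m)) ⟩
      length (stringsOfLengths 0 (1 + m))
        ≡⟨ cong (length ∘ stringsOfLengths 0) (+-comm 1 m) ⟩
      length (stringsOfLengths 0 (m + 1))
        ≡⟨ cong length (stringsOfLengths-+ 0 m 1) ⟩
      length (shorter ++ stringsOfLengths m 1)
        ≡⟨ length-++ shorter ⟩
      length shorter + length (stringsOfLengths m 1)
        ∎
      where open ≡-Reasoning

    diverging⊆programs : diverging ⊆ programs
    diverging⊆programs p∈ with q , q∈ , refl ← ∈-map⁻ (pair w) p∈ =
      ∈-stringsOfLengths⁺ z≤n (s≤s (begin
        len (pair w q)  ≡⟨ length-pair w q ⟩
        k + len q       ≤⟨ +-monoʳ-≤ k (≤-pred (proj₂ (∈-stringsOfLengths⁻ {0} {suc m} q∈))) ⟩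
        k + m           ≤⟨ n≤1+n (k + m) ⟩
        n               ∎))
      where open ≤-Reasoning

    module _ (part : Partition Incompressible Describes candidates) where
      open Partition part

      descriptions⊆programs : descriptions ⊆ programs
      descriptions⊆programs p∈ with _ , p≤n , _ ← Any.satisfied (All.lookup all-describe p∈) =
        ∈-stringsOfLengths⁺ z≤n (s≤s p≤n)

      descriptions-halt : Disjoint descriptions diverging
      descriptions-halt (p∈ , p∈diverging)
        with q , _ , refl ← ∈-map⁻ (pair w) p∈diverging
           | x , _ , halts ← Any.satisfied (All.lookup all-describe p∈) = w-diverges q y x halts

      descriptions-fit : length descriptions + length diverging ≤ length programs
      descriptions-fit = subst (_≤ length programs) (length-++ descriptions)
        (Unique-⊆⇒length≤ (Unique.++⁺ descriptions-unique diverging-unique descriptions-halt)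
          λ p∈ → [ descriptions⊆programs , diverging⊆programs ]′ (∈-++⁻ descriptions p∈))

      many-good : 2 ^ m ≤ length good
      many-good = begin
        2 ^ m                          ≡⟨ length-stringsOfLength m ⟨
        length (stringsOfLength m)     ≤⟨ length-++-≤ˡ (stringsOfLength m) ⟩
        length (stringsOfLengths m 1)  ≤⟨ d+[a+e]≤a+[g+d]⇒e≤g (length shorter) (length descriptions) _ _ counted ⟩
        length good                    ∎
        where
        open ≤-Reasoning
        counted : length descriptions + (length shorter + length (stringsOfLengths m 1))
                ≤ length shorter + (length good + length descriptions)
        counted = begin
          length descriptions + (length shorter + length (stringsOfLengths m 1))
            ≡⟨ cong (length descriptions +_) length-diverging ⟨
          length descriptions + length diverging
            ≤⟨ descriptions-fit ⟩
          length programs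
            ≡⟨ length-programs ⟩
          length shorter + length candidates
            ≡⟨ cong (length shorter +_) length-partition ⟩
          length shorter + (length good + length descriptions)
            ∎

      good-valid : All (λ x → n ∸ suc k ≤ len x × len x ≤ n × Incompressible x) good
      good-valid = All.tabulate λ x∈ → valid (good⊆ x∈) (All.lookup all-good x∈)
        where
        valid : ∀ {x} → x ∈ candidates → Incompressible x →
                n ∸ suc k ≤ len x × len x ≤ n × Incompressible x
        valid {x} x∈ incompressible with m≤x , x<m+k+2 ← ∈-stringsOfLengths⁻ {m} {suc (suc k)} x∈ =
          subst (_≤ len x) (sym (m+n∸m≡n (suc k) m)) m≤x ,
          ≤-pred (subst (len x <_) (+-comm m (suc (suc k))) x<m+k+2) ,
          incompressible

      witness : Σ (List Str) λ xs → Unique xs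
                × All (λ x → n ∸ suc k ≤ len x × len x ≤ n × Incompressible x) xs
                × 2 ^ n / 2 ^ suc k ≤ length xs
      witness = good , good-unique , good-valid ,
                subst (_≤ length good) (sym (m^[n+o]/m^n≡m^o 2 (suc k) m)) many-good

    atLeastIncompressible : AtLeastStrings (2 ^ suc k) 2^[1+k]>0 (suc k) n Incompressible
    atLeastIncompressible =
      ¬¬-map (witness ∘ partition Incompressible Describes describes-functional candidates-unique)
             (All.sequenceM 0ℓ ¬¬-Monad
               (All.universal (λ _ → ¬¬-exceeds-or-described {U} {y = y}) candidates))

  eventuallyManyIncompressible : (y : ℕ → Str) →
    Σ ℕ λ c → Σ ℕ λ d → Σ (0 < c) λ _ → Σ (0 < d) λ d>0 → Σ ℕ λ N →
      ∀ n → N ≤ n → AtLeastStrings d d>0 c n (λ x → CondCExceeds U x (y n) n)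
  eventuallyManyIncompressible y = suc k , 2 ^ suc k , z<s , 2^[1+k]>0 , suc k , beyond
    where
    beyond : ∀ n → suc k ≤ n →
             AtLeastStrings (2 ^ suc k) 2^[1+k]>0 (suc k) n (λ x → CondCExceeds U x (y n) n)
    beyond _ k<n with m , refl ← m≤n⇒∃[o]m+o≡n k<n =
      Counting.atLeastIncompressible (y (suc k + m)) m

theorem2 : (T : ℕ → TM) → Enumerates T → (U : TM) → UniversalFor T U →
    (Σ ℕ λ c → Σ ℕ λ d → Σ (0 < c) λ _ → Σ (0 < d) λ d>0 → Σ ℕ λ N →
       ∀ n → N ≤ n → AtLeastStrings d d>0 c n (λ x → CondCExceeds U x (natStr n) n))
    ×
    (Σ ℕ λ c → Σ ℕ λ d → Σ (0 < c) λ _ → Σ (0 < d) λ d>0 → Σ ℕ λ N →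
       ∀ n → N ≤ n → AtLeastStrings d d>0 c n (λ x → CExceeds U x n))
theorem2 T enum U univ with w , w-diverges ← diverging-prefix {T} {U} enum univ =
  eventuallyManyIncompressible natStr , eventuallyManyIncompressible (λ _ → [])
  where open DivergingPrefix U w w-diverges
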